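{- Let $n\ge 1$ and let $A\subset C_n=\{0,1\}^n$ be a non-empty set. Let $$\Delta(A)=\frac{1}{2^n}\sum_{x\in C_n}\operatorname{dist}(x,A),\qquad \rho=\frac12-\frac{\Delta(A)}{n}.$$ Then $$1-H\Bigl(\frac12-\rho\Bigr)\le \frac{\log_2|A|}{n}\le H(\rho).$$
   Context: $C_n=\{0,1\}^n$ is the Boolean cube. For $a=(\alpha_1,\dots,\alpha_n)$, $b=(\beta_1,\dots,\beta_n)\in C_n$ the Hamming distance is $\operatorname{dist}(a,b)=|\{i:\alpha_i\ne\beta_i\}|$, and for non-empty $B\subset C_n$, $\operatorname{dist}(a,B)=\min_{b\in B}\operatorname{dist}(a,b)$. The entropy function is $H(x)=x\log_2\frac1x+(1-x)\log_2\frac1{1-x}$ for $0\le x\le 1/2$, with $H(0)=0$. (For non-empty $A$ one has $0\le\rho\le 1/2$.) -}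

module Defs where

open import Data.Bool using (Bool; true; false; if_then_else_)
open import Data.Nat using (ℕ; zero; suc; _+_; _*_; _∸_; _^_; _⊓_)
open import Data.List using (List; []; _∷_; map; foldr; length; concatMap; filter)
open import Data.Nat.ListAction using (sum)
open import Data.Vec using (Vec; []; _∷_)
open import Data.Bool.Properties using () renaming (_≟_ to _≟ᵇ_)
open import Relation.Nullary.Decidable using (does)
open import Relation.Binary.PropositionalEquality using (_≡_)
open import Data.Product using (∃)

Cube : ℕ → Set
Cube n = Vec Bool n

allPoints : (n : ℕ) → List (Cube n)
allPoints zero = [] ∷ []
allPoints (suc n) = concatMap (λ v → (false ∷ v) ∷ (true ∷ v) ∷ []) (allPoints n)

dist : {n : ℕ} → Cube n → Cube n → ℕ
dist [] [] = 0
dist (a ∷ as) (b ∷ bs) = (if does (a ≟ᵇ b) then 0 else 1) + dist as bs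

SubsetC : ℕ → Set
SubsetC n = Cube n → Bool

-- The elements of A, listed (without repetition, since allPoints has none).
elems : {n : ℕ} → SubsetC n → List (Cube n)
elems {n} A = filter (λ x → A x ≟ᵇ true) (allPoints n)

card : {n : ℕ} → SubsetC n → ℕ
card A = length (elems A)

NonEmpty : {n : ℕ} → SubsetC n → Set
NonEmpty {n} A = ∃ λ (a : Cube n) → A a ≡ true

-- dist(x, A) = min_{b ∈ A} dist(x,b).  The fold starts at n, which is an
-- upper bound for every Hamming distance, so for non-empty A this is exactly the minimum.
distSet : {n : ℕ} → Cube n → SubsetC n → ℕ
distSet {n} x A = foldr (λ b m → dist x b ⊓ m) n (elems A)

-- S(A) = Σ_{x ∈ C_n} dist(x, A) = 2^n · Δ(A).
totalDist : {n : ℕ} → SubsetC n → ℕ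
totalDist {n} A = sum (map (λ x → distSet x A) (allPoints n))

-- Write S for the total distance, so Δ(A) = S / 2^n, and clear all logarithms.
--
-- Lower bound: with T = n 2^n - S, the weights x ↦ S^d(x,A) T^(n-d(x,A)) have product S^S T^T, which by
-- AM–GM is at most (Σ / 2^n)^(2^n); and Σ ≤ |A| (S + T)^n because each a ∈ A contributes one binomial expansion.
--
-- Upper bound: induction on n, splitting A into its facets A₀ (the larger) and A₁, with total distances S₀, S₁
-- in dimension n - 1. A point on the side of A₁ is within distance 1 plus its facet distance of A₀, which gives
--   |A| S + |A₁| 2^(n-1) ≤ 2 |A₁| S₁ + 2 |A₀| S₀ + |A₀| 2^(n-1);
-- concavity of the entropy (a weighted AM–GM, i.e. the log-sum inequality) then combines the bounds for A₀
-- and A₁ with |A| = |A₀| + |A₁| into the bound for A.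
module Submission where

open import Defs
open import Data.Bool using (Bool; true; false; not; if_then_else_)
open import Data.Bool.Properties using () renaming (_≟_ to _≟ᵇ_)
open import Data.List using (List; []; _∷_; map; foldr; length; filter; concatMap)
open import Data.List.Membership.Propositional using (_∈_)
open import Data.List.Membership.Propositional.Properties using (∈-filter⁺; ∈-filter⁻)
open import Data.List.Properties using (map-cong; length-filter)
open import Data.List.Relation.Unary.Any using (here; there)
open import Data.Nat
open import Data.Nat.ListAction using (sum; product)
open import Data.Nat.Properties
open import Data.Nat.Tactic.RingSolver using (solve-∀)
open import Data.Product using (_×_; _,_; ∃; proj₂)
open import Data.Sum using (_⊎_; inj₁; inj₂)
open import Data.Vec using ([]; _∷_)
open import Relation.Binary.PropositionalEquality
open import Relation.Nullary using (yes; no; contradiction)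
open import Relation.Nullary.Decidable using (does)
open import Algebra.Properties.CommutativeSemigroup *-commutativeSemigroup using (interchange; x∙yz≈y∙xz)
open import Algebra.Properties.CommutativeSemigroup +-commutativeSemigroup
  using () renaming (interchange to +-interchange)

-- Powers and the weighted AM–GM inequality

^-distribʳ-* : ∀ m n o → (m * n) ^ o ≡ m ^ o * n ^ o
^-distribʳ-* m n zero    = refl
^-distribʳ-* m n (suc o) =
  trans (cong (m * n *_) (^-distribʳ-* m n o)) (interchange m n (m ^ o) (n ^ o))

[m^n]^o≡m^[o*n] : ∀ m n o → (m ^ n) ^ o ≡ m ^ (o * n)
[m^n]^o≡m^[o*n] m n o = trans (^-*-assoc m n o) (cong (m ^_) (*-comm n o))

n^n>0 : ∀ n → 0 < n ^ n
n^n>0 zero    = z<s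
n^n>0 (suc n) = m^n>0 (suc n) (suc n)

^-cancelʳ-≤ : ∀ o {m n} → 0 < o → m ^ o ≤ n ^ o → m ≤ n
^-cancelʳ-≤ o {m} {n} o>0 mᵒ≤nᵒ with m ≤? n
... | yes m≤n = m≤n
... | no  m≰n = contradiction mᵒ≤nᵒ (<⇒≱ (^-monoˡ-< o {{>-nonZero o>0}} (≰⇒> m≰n)))

m≤n⇒2mn≤m²+n² : ∀ {m n} → m ≤ n → 2 * (m * n) ≤ m * m + n * n
m≤n⇒2mn≤m²+n² {m} m≤n with m≤n⇒∃[o]m+o≡n m≤n
... | d , refl = subst (2 * (m * (m + d)) ≤_) (square-gap m d) (m≤m+n _ (d * d))
  where
  square-gap : ∀ m d → 2 * (m * (m + d)) + d * d ≡ m * m + (m + d) * (m + d)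
  square-gap = solve-∀

2mn≤m²+n² : ∀ m n → 2 * (m * n) ≤ m * m + n * n
2mn≤m²+n² m n with ≤-total m n
... | inj₁ m≤n = m≤n⇒2mn≤m²+n² m≤n
... | inj₂ n≤m = subst₂ _≤_ (cong (2 *_) (*-comm n m)) (+-comm (n * n) (m * m)) (m≤n⇒2mn≤m²+n² n≤m)

4mn≤[m+n]² : ∀ m n → 4 * (m * n) ≤ (m + n) * (m + n)
4mn≤[m+n]² m n = subst₂ _≤_ (double m n) (square m n) (+-monoʳ-≤ (2 * (m * n)) (2mn≤m²+n² m n))
  where
  double : ∀ m n → 2 * (m * n) + 2 * (m * n) ≡ 4 * (m * n)
  double = solve-∀
  square : ∀ m n → 2 * (m * n) + (m * m + n * n) ≡ (m + n) * (m + n)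
  square = solve-∀

-- y^(k+1) ≥ x^(k+1) + (k+1) x^k (y - x), rearranged to avoid truncated subtraction.
^-tangent-≤ : ∀ k x y → suc k * (x ^ k * y) ≤ y ^ suc k + k * x ^ suc k
^-tangent-≤ zero    x y = ≤-reflexive (one x y)
  where
  one : ∀ x y → 1 * (1 * y) ≡ y * 1 + 0
  one = solve-∀
^-tangent-≤ (suc k) x y = +-cancelʳ-≤ (k * (x * xᵏ * y)) _ _ (begin
    suc (suc k) * (x * xᵏ * y) + k * (x * xᵏ * y) ≡⟨ regroup₁ k x xᵏ y ⟩
    suc k * xᵏ * (2 * (x * y))                    ≤⟨ *-monoʳ-≤ (suc k * xᵏ) (2mn≤m²+n² x y) ⟩
    suc k * xᵏ * (x * x + y * y)                  ≡⟨ regroup₂ k x xᵏ y ⟩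
    suc k * (xᵏ * y) * y + suc k * (x * (x * xᵏ)) ≤⟨ +-monoˡ-≤ _ (*-monoˡ-≤ y (^-tangent-≤ k x y)) ⟩
    (y ^ suc k + k * (x * xᵏ)) * y + suc k * (x * (x * xᵏ))
      ≡⟨ regroup₃ k x xᵏ y (y ^ suc k) ⟩
    (y * y ^ suc k + suc k * (x * (x * xᵏ))) + k * (x * xᵏ * y) ∎)
  where
  open ≤-Reasoning
  xᵏ = x ^ k
  regroup₁ : ∀ k x q y → suc (suc k) * (x * q * y) + k * (x * q * y) ≡ suc k * q * (2 * (x * y))
  regroup₁ = solve-∀
  regroup₂ : ∀ k x q y → suc k * q * (x * x + y * y) ≡ suc k * (q * y) * y + suc k * (x * (x * q))
  regroup₂ = solve-∀
  regroup₃ : ∀ k x q y p → (p + k * (x * q)) * y + suc k * (x * (x * q))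
                           ≡ (y * p + suc k * (x * (x * q))) + k * (x * q * y)
  regroup₃ = solve-∀

-- (M/N)^N · z ≤ ((M+z)/(N+1))^(N+1), cleared of denominators: the tangent inequality at x = (N+1)M, y = N(M+z).
weighted-amgm₁ : ∀ N M z → M ^ N * z * suc N ^ suc N ≤ N ^ N * (M + z) ^ suc N
weighted-amgm₁ zero M z = subst₂ _≤_ (unitˡ z) (unitʳ (M + z)) (m≤n+m z M)
  where
  unitˡ : ∀ z → z ≡ 1 * z * (1 * 1)
  unitˡ = solve-∀
  unitʳ : ∀ s → s ≡ 1 * (s * 1)
  unitʳ = solve-∀
weighted-amgm₁ N@(suc _) M z = *-cancelˡ-≤ N (begin
    N * (M ^ N * z * suc N ^ suc N)      ≡⟨ regroup N (suc N ^ N) (M ^ N) z ⟩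
    suc N * (suc N ^ N * M ^ N * (N * z)) ≡⟨ cong (λ p → suc N * (p * (N * z))) (sym (^-distribʳ-* (suc N) M N)) ⟩
    suc N * (x ^ N * (N * z))            ≤⟨ tangent ⟩
    y ^ suc N                            ≡⟨ ^-distribʳ-* N (M + z) (suc N) ⟩
    N * N ^ N * (M + z) ^ suc N          ≡⟨ *-assoc N (N ^ N) _ ⟩
    N * (N ^ N * (M + z) ^ suc N)        ∎)
  where
  open ≤-Reasoning
  x = suc N * M
  y = N * (M + z)
  regroup : ∀ N p q z → N * (q * z * (suc N * p)) ≡ suc N * (p * q * (N * z))
  regroup = solve-∀
  split : ∀ N M z q → suc N * (q * (N * (M + z))) ≡ N * (suc N * M * q) + suc N * (q * (N * z))
  split = solve-∀
  tangent : suc N * (x ^ N * (N * z)) ≤ y ^ suc N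
  tangent = +-cancelˡ-≤ (N * x ^ suc N) _ _ (begin
    N * x ^ suc N + suc N * (x ^ N * (N * z)) ≡⟨ split N M z (x ^ N) ⟨
    suc N * (x ^ N * y)                      ≤⟨ ^-tangent-≤ N x y ⟩
    y ^ suc N + N * x ^ suc N                ≡⟨ +-comm (y ^ suc N) _ ⟩
    N * x ^ suc N + y ^ suc N                ∎)

-- (x/a)^a (y/c)^c ≤ ((x+y)/(a+c))^(a+c) with denominators cleared. The step c → c+1 applies the induction
-- hypothesis to ((c+1)x, cy) and weighted-amgm₁ to the last unit of weight on y.
weighted-amgm : ∀ a c x y → x ^ a * y ^ c * (a + c) ^ (a + c) ≤ (x + y) ^ (a + c) * (a ^ a * c ^ c)
weighted-amgm a zero x y rewrite +-identityʳ a =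
  subst₂ _≤_ (unitˡ (x ^ a) (a ^ a)) (unitʳ ((x + y) ^ a) (a ^ a))
    (*-monoˡ-≤ (a ^ a) (^-monoˡ-≤ a (m≤m+n x y)))
  where
  unitˡ : ∀ p q → p * q ≡ p * 1 * q
  unitˡ = solve-∀
  unitʳ : ∀ p q → p * q ≡ p * (q * 1)
  unitʳ = solve-∀
weighted-amgm a (suc c) x y rewrite +-suc a c = *-cancelˡ-≤ Z {{>-nonZero Z>0}} (begin
    Z * (x ^ a * (y * y ^ c) * suc N ^ suc N)
      ≡⟨ regroup₁ (suc c ^ a) (c ^ c) (N ^ N) (x ^ a) y (y ^ c) (suc N ^ suc N) ⟩
    suc c ^ a * x ^ a * (c ^ c * y ^ c) * N ^ N * (y * suc N ^ suc N)
      ≡⟨ cong₂ (λ p q → p * q * N ^ N * (y * suc N ^ suc N)) (^-distribʳ-* (suc c) x a) (^-distribʳ-* c y c) ⟨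
    (suc c * x) ^ a * (c * y) ^ c * N ^ N * (y * suc N ^ suc N)
      ≤⟨ *-monoˡ-≤ (y * suc N ^ suc N) (weighted-amgm a c (suc c * x) (c * y)) ⟩
    M ^ N * (a ^ a * c ^ c) * (y * suc N ^ suc N)
      ≡⟨ regroup₂ (M ^ N) (a ^ a) (c ^ c) y (suc N ^ suc N) ⟩
    a ^ a * c ^ c * (M ^ N * y * suc N ^ suc N)
      ≤⟨ *-monoʳ-≤ (a ^ a * c ^ c) (weighted-amgm₁ N M y) ⟩
    a ^ a * c ^ c * (N ^ N * (M + y) ^ suc N)
      ≡⟨ cong (λ p → a ^ a * c ^ c * (N ^ N * p ^ suc N)) (M+y c x y) ⟩
    a ^ a * c ^ c * (N ^ N * (suc c * (x + y)) ^ suc N)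
      ≡⟨ cong (λ p → a ^ a * c ^ c * (N ^ N * p)) (^-distribʳ-* (suc c) (x + y) (suc N)) ⟩
    a ^ a * c ^ c * (N ^ N * (suc c ^ suc N * (x + y) ^ suc N))
      ≡⟨ cong (λ p → a ^ a * c ^ c * (N ^ N * (p * (x + y) ^ suc N))) split-exponent ⟩
    a ^ a * c ^ c * (N ^ N * (suc c ^ a * suc c ^ suc c * (x + y) ^ suc N))
      ≡⟨ regroup₃ (a ^ a) (c ^ c) (N ^ N) (suc c ^ a) (suc c ^ suc c) ((x + y) ^ suc N) ⟩
    Z * ((x + y) ^ suc N * (a ^ a * suc c ^ suc c)) ∎)
  where
  open ≤-Reasoning
  N = a + c
  M = suc c * x + c * y
  Z = suc c ^ a * c ^ c * N ^ N
  Z>0 : 0 < Z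
  Z>0 = *-mono-≤ (*-mono-≤ (m^n>0 (suc c) a) (n^n>0 c)) (n^n>0 N)
  M+y : ∀ c x y → suc c * x + c * y + y ≡ suc c * (x + y)
  M+y = solve-∀
  split-exponent : suc c ^ suc N ≡ suc c ^ a * suc c ^ suc c
  split-exponent = trans (cong (suc c ^_) (sym (+-suc a c))) (^-distribˡ-+-* (suc c) a (suc c))
  regroup₁ : ∀ A C P xa y yc Q → A * C * P * (xa * (y * yc) * Q) ≡ A * xa * (C * yc) * P * (y * Q)
  regroup₁ = solve-∀
  regroup₂ : ∀ m p q y Q → m * (p * q) * (y * Q) ≡ p * q * (m * y * Q)
  regroup₂ = solve-∀
  regroup₃ : ∀ p q P A B s → p * q * (P * (A * B * s)) ≡ A * q * P * (s * (p * B))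
  regroup₃ = solve-∀

gibbs : ∀ a c x y → x + y ≡ a + c → x ^ a * y ^ c ≤ a ^ a * c ^ c
gibbs a c x y x+y≡a+c = *-cancelʳ-≤ _ _ ((a + c) ^ (a + c)) {{>-nonZero (n^n>0 (a + c))}} (begin
    x ^ a * y ^ c * (a + c) ^ (a + c)       ≤⟨ weighted-amgm a c x y ⟩
    (x + y) ^ (a + c) * (a ^ a * c ^ c)     ≡⟨ cong (λ s → s ^ (a + c) * (a ^ a * c ^ c)) x+y≡a+c ⟩
    (a + c) ^ (a + c) * (a ^ a * c ^ c)     ≡⟨ *-comm ((a + c) ^ (a + c)) _ ⟩
    a ^ a * c ^ c * (a + c) ^ (a + c)       ∎)
  where open ≤-Reasoning

selfPow-balance : ∀ {u v u′ v′} → u ≤ u′ → u′ ≤ v′ → u′ + v′ ≡ u + v → u′ ^ u′ * v′ ^ v′ ≤ u ^ u * v ^ v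
selfPow-balance {u} {v} {u′} {v′} u≤u′ u′≤v′ sum≡ with m≤n⇒∃[o]m+o≡n u≤u′
... | d , refl = begin
    (u + d) ^ (u + d) * v′ ^ v′          ≡⟨ cong (_* v′ ^ v′) (^-distribˡ-+-* (u + d) u d) ⟩
    (u + d) ^ u * (u + d) ^ d * v′ ^ v′  ≤⟨ *-monoˡ-≤ (v′ ^ v′) (*-monoʳ-≤ ((u + d) ^ u) (^-monoˡ-≤ d u′≤v′)) ⟩
    (u + d) ^ u * v′ ^ d * v′ ^ v′       ≡⟨ *-assoc ((u + d) ^ u) _ _ ⟩
    (u + d) ^ u * (v′ ^ d * v′ ^ v′)     ≡⟨ cong ((u + d) ^ u *_) (^-distribˡ-+-* v′ d v′) ⟨
    (u + d) ^ u * v′ ^ (d + v′)          ≡⟨ cong (λ e → (u + d) ^ u * v′ ^ e) d+v′≡v ⟩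
    (u + d) ^ u * v′ ^ v                 ≤⟨ gibbs u v (u + d) v′ sum≡ ⟩
    u ^ u * v ^ v                        ∎
  where
  open ≤-Reasoning
  d+v′≡v : d + v′ ≡ v
  d+v′≡v = +-cancelˡ-≡ u _ _ (trans (sym (+-assoc u d v′)) sum≡)

-- Entropy bounds

-- (u+v)^(u+v) / (u^u v^v) = exp ((u+v) h(u/(u+v))) with h the binary entropy in nats,
-- so EntropyBound W D u v says ln W ≤ ln D + (u+v) h(u/(u+v)).
record EntropyBound (W D u v : ℕ) : Set where
  constructor entropyBound
  field
    bound : W * (u ^ u * v ^ v) ≤ D * (u + v) ^ (u + v)

entropyBound-exact : ∀ u v → EntropyBound ((u + v) ^ (u + v)) (u ^ u * v ^ v) u v
entropyBound-exact u v = entropyBound (≤-reflexive (*-comm ((u + v) ^ (u + v)) (u ^ u * v ^ v)))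

entropyBound-0^ : ∀ {k D u v} → 0 < k → EntropyBound (0 ^ k) D u v
entropyBound-0^ {suc k} _ = entropyBound z≤n

entropyBound-balance : ∀ {W D u v u′ v′} → u ≤ u′ → u′ ≤ v′ → u′ + v′ ≡ u + v →
                       EntropyBound W D u v → EntropyBound W D u′ v′
entropyBound-balance {W} {D} u≤u′ u′≤v′ sum≡ (entropyBound Φ≤Γ) = entropyBound
  (≤-trans (*-monoʳ-≤ W (selfPow-balance u≤u′ u′≤v′ sum≡))
    (≤-trans Φ≤Γ (≤-reflexive (cong (λ s → D * s ^ s) (sym sum≡)))))

entropyBound-superadditive : ∀ u₁ v₁ u₂ v₂ →
  EntropyBound ((u₁ + v₁) ^ (u₁ + v₁) * (u₂ + v₂) ^ (u₂ + v₂)) (u₁ ^ u₁ * v₁ ^ v₁ * (u₂ ^ u₂ * v₂ ^ v₂))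
               (u₁ + u₂) (v₁ + v₂)
entropyBound-superadditive u₁ v₁ u₂ v₂ = entropyBound (begin
    Γ₁ * Γ₂ * (u ^ u * v ^ v)
      ≡⟨ cong₂ (λ p q → Γ₁ * Γ₂ * (p * q)) (^-distribˡ-+-* u u₁ u₂) (^-distribˡ-+-* v v₁ v₂) ⟩
    Γ₁ * Γ₂ * (u ^ u₁ * u ^ u₂ * (v ^ v₁ * v ^ v₂))
      ≡⟨ regroup Γ₁ Γ₂ (u ^ u₁) (u ^ u₂) (v ^ v₁) (v ^ v₂) ⟩
    u ^ u₁ * v ^ v₁ * Γ₁ * (u ^ u₂ * v ^ v₂ * Γ₂)
      ≤⟨ *-mono-≤ (weighted-amgm u₁ v₁ u v) (weighted-amgm u₂ v₂ u v) ⟩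
    (u + v) ^ (u₁ + v₁) * Φ₁ * ((u + v) ^ (u₂ + v₂) * Φ₂)
      ≡⟨ interchange ((u + v) ^ (u₁ + v₁)) Φ₁ _ Φ₂ ⟩
    (u + v) ^ (u₁ + v₁) * (u + v) ^ (u₂ + v₂) * (Φ₁ * Φ₂)
      ≡⟨ cong (_* (Φ₁ * Φ₂)) (^-distribˡ-+-* (u + v) (u₁ + v₁) (u₂ + v₂)) ⟨
    (u + v) ^ (u₁ + v₁ + (u₂ + v₂)) * (Φ₁ * Φ₂)
      ≡⟨ cong (λ e → (u + v) ^ e * (Φ₁ * Φ₂)) (+-interchange u₁ v₁ u₂ v₂) ⟩
    (u + v) ^ (u + v) * (Φ₁ * Φ₂)
      ≡⟨ *-comm ((u + v) ^ (u + v)) _ ⟩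
    Φ₁ * Φ₂ * (u + v) ^ (u + v) ∎)
  where
  open ≤-Reasoning
  u = u₁ + u₂
  v = v₁ + v₂
  Γ₁ = (u₁ + v₁) ^ (u₁ + v₁)
  Γ₂ = (u₂ + v₂) ^ (u₂ + v₂)
  Φ₁ = u₁ ^ u₁ * v₁ ^ v₁
  Φ₂ = u₂ ^ u₂ * v₂ ^ v₂
  regroup : ∀ g₁ g₂ p₁ p₂ q₁ q₂ → g₁ * g₂ * (p₁ * p₂ * (q₁ * q₂)) ≡ p₁ * q₁ * g₁ * (p₂ * q₂ * g₂)
  regroup = solve-∀

entropyBound-* : ∀ {W₁ D₁ u₁ v₁ W₂ D₂ u₂ v₂} → EntropyBound W₁ D₁ u₁ v₁ → EntropyBound W₂ D₂ u₂ v₂ →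
                 EntropyBound (W₁ * W₂) (D₁ * D₂) (u₁ + u₂) (v₁ + v₂)
entropyBound-* {W₁} {D₁} {u₁} {v₁} {W₂} {D₂} {u₂} {v₂} (entropyBound bound₁) (entropyBound bound₂) = entropyBound (
  *-cancelʳ-≤ _ _ (Φ₁ * Φ₂) {{>-nonZero (*-mono-≤ (Φ>0 u₁ v₁) (Φ>0 u₂ v₂))}} (begin
    W₁ * W₂ * Φ * (Φ₁ * Φ₂)          ≡⟨ regroup₁ W₁ W₂ Φ Φ₁ Φ₂ ⟩
    W₁ * Φ₁ * (W₂ * Φ₂) * Φ          ≤⟨ *-monoˡ-≤ Φ (*-mono-≤ bound₁ bound₂) ⟩
    D₁ * Γ₁ * (D₂ * Γ₂) * Φ          ≡⟨ regroup₂ D₁ D₂ Γ₁ Γ₂ Φ ⟩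
    D₁ * D₂ * (Γ₁ * Γ₂ * Φ)
      ≤⟨ *-monoʳ-≤ (D₁ * D₂) (EntropyBound.bound (entropyBound-superadditive u₁ v₁ u₂ v₂)) ⟩
    D₁ * D₂ * (Φ₁ * Φ₂ * Γ)          ≡⟨ cong (D₁ * D₂ *_) (*-comm (Φ₁ * Φ₂) Γ) ⟩
    D₁ * D₂ * (Γ * (Φ₁ * Φ₂))        ≡⟨ *-assoc (D₁ * D₂) Γ (Φ₁ * Φ₂) ⟨
    D₁ * D₂ * Γ * (Φ₁ * Φ₂)          ∎))
  where
  open ≤-Reasoning
  Φ>0 : ∀ u v → 0 < u ^ u * v ^ v
  Φ>0 u v = *-mono-≤ (n^n>0 u) (n^n>0 v)
  Φ₁ = u₁ ^ u₁ * v₁ ^ v₁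
  Φ₂ = u₂ ^ u₂ * v₂ ^ v₂
  Φ = (u₁ + u₂) ^ (u₁ + u₂) * (v₁ + v₂) ^ (v₁ + v₂)
  Γ₁ = (u₁ + v₁) ^ (u₁ + v₁)
  Γ₂ = (u₂ + v₂) ^ (u₂ + v₂)
  Γ = (u₁ + u₂ + (v₁ + v₂)) ^ (u₁ + u₂ + (v₁ + v₂))
  regroup₁ : ∀ a b f p q → a * b * f * (p * q) ≡ a * p * (b * q) * f
  regroup₁ = solve-∀
  regroup₂ : ∀ a b c d f → a * c * (b * d) * f ≡ a * b * (c * d * f)
  regroup₂ = solve-∀

entropyBound-chain : ∀ {W₁ W₂ D u₁ v₁ u₂ v₂} → 0 < W₁ →
                     EntropyBound W₁ D u₁ v₁ → EntropyBound W₂ W₁ u₂ v₂ →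
                     EntropyBound W₂ D (u₁ + u₂) (v₁ + v₂)
entropyBound-chain {W₁} {W₂} {D} {u₁} {v₁} {u₂} {v₂} W₁>0 bound₁ bound₂ = entropyBound (
  *-cancelˡ-≤ W₁ {{>-nonZero W₁>0}}
    (subst₂ _≤_ (*-assoc W₁ W₂ _) (trans (cong (_* Γ) (*-comm D W₁)) (*-assoc W₁ D Γ))
      (EntropyBound.bound (entropyBound-* bound₁ bound₂))))
  where
  Γ = (u₁ + u₂ + (v₁ + v₂)) ^ (u₁ + u₂ + (v₁ + v₂))

selfPow-scale : ∀ m u → (m * u) ^ (m * u) ≡ m ^ (m * u) * (u ^ u) ^ m
selfPow-scale m u = trans (^-distribʳ-* m u (m * u)) (cong (m ^ (m * u) *_) (sym ([m^n]^o≡m^[o*n] u u m)))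

entropyBound-scaleˡ : ∀ m W u v → W ^ m * ((m * u) ^ (m * u) * (m * v) ^ (m * v))
                                  ≡ m ^ (m * (u + v)) * (W * (u ^ u * v ^ v)) ^ m
entropyBound-scaleˡ m W u v = begin
    W ^ m * ((m * u) ^ (m * u) * (m * v) ^ (m * v))
      ≡⟨ cong₂ (λ p q → W ^ m * (p * q)) (selfPow-scale m u) (selfPow-scale m v) ⟩
    W ^ m * (m ^ (m * u) * (u ^ u) ^ m * (m ^ (m * v) * (v ^ v) ^ m))
      ≡⟨ regroup (W ^ m) (m ^ (m * u)) ((u ^ u) ^ m) (m ^ (m * v)) ((v ^ v) ^ m) ⟩
    m ^ (m * u) * m ^ (m * v) * (W ^ m * ((u ^ u) ^ m * (v ^ v) ^ m))
      ≡⟨ cong₂ (λ p q → p * (W ^ m * q)) (^-distribˡ-+-* m (m * u) (m * v)) (^-distribʳ-* (u ^ u) (v ^ v) m) ⟨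
    m ^ (m * u + m * v) * (W ^ m * (u ^ u * v ^ v) ^ m)
      ≡⟨ cong₂ (λ e p → m ^ e * p) (*-distribˡ-+ m u v) (^-distribʳ-* W (u ^ u * v ^ v) m) ⟨
    m ^ (m * (u + v)) * (W * (u ^ u * v ^ v)) ^ m ∎
  where
  open ≡-Reasoning
  regroup : ∀ w a p b q → w * (a * p * (b * q)) ≡ a * b * (w * (p * q))
  regroup = solve-∀

entropyBound-scaleʳ : ∀ m D u v → D ^ m * (m * u + m * v) ^ (m * u + m * v)
                                  ≡ m ^ (m * (u + v)) * (D * (u + v) ^ (u + v)) ^ m
entropyBound-scaleʳ m D u v = begin
    D ^ m * (m * u + m * v) ^ (m * u + m * v)     ≡⟨ cong (λ s → D ^ m * s ^ s) (*-distribˡ-+ m u v) ⟨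
    D ^ m * (m * (u + v)) ^ (m * (u + v))         ≡⟨ cong (D ^ m *_) (selfPow-scale m (u + v)) ⟩
    D ^ m * (m ^ (m * (u + v)) * ((u + v) ^ (u + v)) ^ m) ≡⟨ x∙yz≈y∙xz (D ^ m) (m ^ (m * (u + v))) _ ⟩
    m ^ (m * (u + v)) * (D ^ m * ((u + v) ^ (u + v)) ^ m) ≡⟨ cong (m ^ (m * (u + v)) *_) (^-distribʳ-* D _ m) ⟨
    m ^ (m * (u + v)) * (D * (u + v) ^ (u + v)) ^ m ∎
  where open ≡-Reasoning

entropyBound-^ : ∀ m {W D u v} → EntropyBound W D u v → EntropyBound (W ^ m) (D ^ m) (m * u) (m * v)
entropyBound-^ m {W} {D} {u} {v} (entropyBound Φ≤Γ) = entropyBound (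
  subst₂ _≤_ (sym (entropyBound-scaleˡ m W u v)) (sym (entropyBound-scaleʳ m D u v))
    (*-monoʳ-≤ (m ^ (m * (u + v))) (^-monoˡ-≤ m Φ≤Γ)))

entropyBound-root : ∀ m {W D u v} → 0 < m → EntropyBound (W ^ m) (D ^ m) (m * u) (m * v) → EntropyBound W D u v
entropyBound-root m {W} {D} {u} {v} m>0 (entropyBound Φ≤Γ) = entropyBound (
  ^-cancelʳ-≤ m m>0 (*-cancelˡ-≤ (m ^ (m * (u + v))) {{m^n≢0 m (m * (u + v)) {{>-nonZero m>0}}}}
    (subst₂ _≤_ (entropyBound-scaleˡ m W u v) (entropyBound-scaleʳ m D u v) Φ≤Γ)))

-- Sums over the cube

module _ {A : Set} where

  sum-map-mono : ∀ {f g : A → ℕ} xs → (∀ x → f x ≤ g x) → sum (map f xs) ≤ sum (map g xs)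
  sum-map-mono []       f≤g = z≤n
  sum-map-mono (x ∷ xs) f≤g = +-mono-≤ (f≤g x) (sum-map-mono xs f≤g)

  sum-map-+ : ∀ (f g : A → ℕ) xs → sum (map (λ x → f x + g x) xs) ≡ sum (map f xs) + sum (map g xs)
  sum-map-+ f g []       = refl
  sum-map-+ f g (x ∷ xs) =
    trans (cong (f x + g x +_) (sum-map-+ f g xs)) (+-interchange (f x) (g x) _ _)

  sum-map-*ˡ : ∀ c (f : A → ℕ) xs → sum (map (λ x → c * f x) xs) ≡ c * sum (map f xs)
  sum-map-*ˡ c f []       = sym (*-zeroʳ c)
  sum-map-*ˡ c f (x ∷ xs) = trans (cong (c * f x +_) (sum-map-*ˡ c f xs)) (sym (*-distribˡ-+ c (f x) _))

  sum-map-const : ∀ c (xs : List A) → sum (map (λ _ → c) xs) ≡ length xs * c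
  sum-map-const c []       = refl
  sum-map-const c (x ∷ xs) = cong (c +_) (sum-map-const c xs)

  ∈⇒≤sum-map : ∀ (f : A → ℕ) {x xs} → x ∈ xs → f x ≤ sum (map f xs)
  ∈⇒≤sum-map f {xs = y ∷ xs} (here refl) = m≤m+n (f y) _
  ∈⇒≤sum-map f {xs = y ∷ xs} (there x∈xs) = ≤-trans (∈⇒≤sum-map f x∈xs) (m≤n+m _ (f y))

  product-map-mono : ∀ {f g : A → ℕ} xs → (∀ x → f x ≤ g x) → product (map f xs) ≤ product (map g xs)
  product-map-mono []       f≤g = ≤-refl
  product-map-mono (x ∷ xs) f≤g = *-mono-≤ (f≤g x) (product-map-mono xs f≤g)

  product-map-* : ∀ (f g : A → ℕ) xs →
                  product (map (λ x → f x * g x) xs) ≡ product (map f xs) * product (map g xs)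
  product-map-* f g []       = refl
  product-map-* f g (x ∷ xs) =
    trans (cong (f x * g x *_) (product-map-* f g xs)) (interchange (f x) (g x) _ _)

  product-map-^ : ∀ c (f : A → ℕ) xs → product (map (λ x → c ^ f x) xs) ≡ c ^ sum (map f xs)
  product-map-^ c f []       = refl
  product-map-^ c f (x ∷ xs) =
    trans (cong (c ^ f x *_) (product-map-^ c f xs)) (sym (^-distribˡ-+-* c (f x) _))

cubeSum : (n : ℕ) → (Cube n → ℕ) → ℕ
cubeSum n f = sum (map f (allPoints n))

cubeProduct : (n : ℕ) → (Cube n → ℕ) → ℕ
cubeProduct n f = product (map f (allPoints n))

cubeSum-suc : ∀ n (f : Cube (suc n) → ℕ) → cubeSum (suc n) f ≡ cubeSum n (λ v → f (false ∷ v) + f (true ∷ v))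
cubeSum-suc n f = go (allPoints n)
  where
  go : ∀ vs → sum (map f (concatMap (λ v → (false ∷ v) ∷ (true ∷ v) ∷ []) vs))
              ≡ sum (map (λ v → f (false ∷ v) + f (true ∷ v)) vs)
  go []       = refl
  go (v ∷ vs) = trans (cong (λ s → f (false ∷ v) + (f (true ∷ v) + s)) (go vs))
                      (sym (+-assoc (f (false ∷ v)) (f (true ∷ v)) _))

cubeProduct-suc : ∀ n (f : Cube (suc n) → ℕ) →
                  cubeProduct (suc n) f ≡ cubeProduct n (λ v → f (false ∷ v) * f (true ∷ v))
cubeProduct-suc n f = go (allPoints n)
  where
  go : ∀ vs → product (map f (concatMap (λ v → (false ∷ v) ∷ (true ∷ v) ∷ []) vs))
              ≡ product (map (λ v → f (false ∷ v) * f (true ∷ v)) vs)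
  go []       = refl
  go (v ∷ vs) = trans (cong (λ p → f (false ∷ v) * (f (true ∷ v) * p)) (go vs))
                      (sym (*-assoc (f (false ∷ v)) (f (true ∷ v)) _))

cubeSum-const : ∀ n c → cubeSum n (λ _ → c) ≡ c * 2 ^ n
cubeSum-const zero    c = trans (+-identityʳ c) (sym (*-identityʳ c))
cubeSum-const (suc n) c = trans (cubeSum-suc n (λ _ → c)) (trans (cubeSum-const n (c + c)) (double c (2 ^ n)))
  where
  double : ∀ c N → (c + c) * N ≡ c * (2 * N)
  double = solve-∀

cubeProduct-const : ∀ n c → cubeProduct n (λ _ → c) ≡ c ^ 2 ^ n
cubeProduct-const zero    c = refl
cubeProduct-const (suc n) c = begin
    cubeProduct (suc n) (λ _ → c) ≡⟨ cubeProduct-suc n (λ _ → c) ⟩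
    cubeProduct n (λ _ → c * c)   ≡⟨ cubeProduct-const n (c * c) ⟩
    (c * c) ^ N                   ≡⟨ ^-distribʳ-* c c N ⟩
    c ^ N * c ^ N                 ≡⟨ ^-distribˡ-+-* c N N ⟨
    c ^ (N + N)                   ≡⟨ cong (c ^_) (cong (N +_) (+-identityʳ N)) ⟨
    c ^ (2 * N)                   ∎
  where
  open ≡-Reasoning
  N = 2 ^ n

cube-amgm : ∀ n (f : Cube n → ℕ) → 2 ^ (n * 2 ^ n) * cubeProduct n f ≤ cubeSum n f ^ 2 ^ n
cube-amgm zero    f = ≤-reflexive (unit (f []))
  where
  unit : ∀ a → 1 * (a * 1) ≡ (a + 0) * 1
  unit = solve-∀
cube-amgm (suc n) f = begin
    2 ^ (suc n * (2 * N)) * cubeProduct (suc n) f   ≡⟨ cong₂ _*_ split-exponent (cubeProduct-suc n f) ⟩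
    E * E * 4 ^ N * cubeProduct n f₀f₁             ≡⟨ *-assoc (E * E) (4 ^ N) _ ⟩
    E * E * (4 ^ N * cubeProduct n f₀f₁)           ≡⟨ cong (λ p → E * E * (p * cubeProduct n f₀f₁)) (cubeProduct-const n 4) ⟨
    E * E * (cubeProduct n (λ _ → 4) * cubeProduct n f₀f₁)
      ≡⟨ cong (E * E *_) (product-map-* (λ _ → 4) f₀f₁ (allPoints n)) ⟨
    E * E * cubeProduct n (λ v → 4 * f₀f₁ v)
      ≤⟨ *-monoʳ-≤ (E * E) (product-map-mono (allPoints n) (λ v → 4mn≤[m+n]² (f (false ∷ v)) (f (true ∷ v)))) ⟩
    E * E * cubeProduct n (λ v → g v * g v)         ≡⟨ cong (E * E *_) (product-map-* g g (allPoints n)) ⟩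
    E * E * (cubeProduct n g * cubeProduct n g)     ≡⟨ interchange E E (cubeProduct n g) (cubeProduct n g) ⟩
    E * cubeProduct n g * (E * cubeProduct n g)     ≤⟨ *-mono-≤ (cube-amgm n g) (cube-amgm n g) ⟩
    cubeSum n g ^ N * cubeSum n g ^ N               ≡⟨ ^-distribˡ-+-* (cubeSum n g) N N ⟨
    cubeSum n g ^ (N + N)                           ≡⟨ cong (λ e → cubeSum n g ^ (N + e)) (sym (+-identityʳ N)) ⟩
    cubeSum n g ^ (2 * N)                           ≡⟨ cong (_^ (2 * N)) (cubeSum-suc n f) ⟨
    cubeSum (suc n) f ^ (2 * N)                     ∎
  where
  open ≤-Reasoning
  N = 2 ^ n
  E = 2 ^ (n * N)
  f₀f₁ g : Cube n → ℕ
  f₀f₁ v = f (false ∷ v) * f (true ∷ v)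
  g    v = f (false ∷ v) + f (true ∷ v)
  exponent : ∀ n N → suc n * (2 * N) ≡ n * N + n * N + 2 * N
  exponent = solve-∀
  split-exponent : 2 ^ (suc n * (2 * N)) ≡ E * E * 4 ^ N
  split-exponent = begin-equality
    2 ^ (suc n * (2 * N))             ≡⟨ cong (2 ^_) (exponent n N) ⟩
    2 ^ (n * N + n * N + 2 * N)       ≡⟨ ^-distribˡ-+-* 2 (n * N + n * N) (2 * N) ⟩
    2 ^ (n * N + n * N) * 2 ^ (2 * N) ≡⟨ cong₂ _*_ (^-distribˡ-+-* 2 (n * N) (n * N)) (sym (^-*-assoc 2 2 N)) ⟩
    E * E * 4 ^ N                     ∎

-- Hamming distance

bitDist : Bool → Bool → ℕ
bitDist a b = if does (a ≟ᵇ b) then 0 else 1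

bitDist≤1 : ∀ a b → bitDist a b ≤ 1
bitDist≤1 a b with does (a ≟ᵇ b)
... | true  = z≤n
... | false = ≤-refl

bitDist-self : ∀ b → bitDist b b ≡ 0
bitDist-self false = refl
bitDist-self true  = refl

bitDist-not : ∀ b → bitDist (not b) b ≡ 1
bitDist-not false = refl
bitDist-not true  = refl

dist≤n : ∀ {n} (x a : Cube n) → dist x a ≤ n
dist≤n []      []      = z≤n
dist≤n (b ∷ x) (c ∷ a) = +-mono-≤ (bitDist≤1 b c) (dist≤n x a)

cubeSum-binomial : ∀ α β n (a : Cube n) → cubeSum n (λ x → α ^ dist x a * β ^ (n ∸ dist x a)) ≡ (α + β) ^ n
cubeSum-binomial α β zero    []      = refl
cubeSum-binomial α β (suc n) (b ∷ a) = begin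
    cubeSum (suc n) term                                ≡⟨ cubeSum-suc n term ⟩
    cubeSum n (λ v → term (false ∷ v) + term (true ∷ v)) ≡⟨ cong sum (map-cong (neighbours b) (allPoints n)) ⟩
    cubeSum n (λ v → (α + β) * term₀ v)                 ≡⟨ sum-map-*ˡ (α + β) term₀ (allPoints n) ⟩
    (α + β) * cubeSum n term₀                           ≡⟨ cong ((α + β) *_) (cubeSum-binomial α β n a) ⟩
    (α + β) * (α + β) ^ n                               ∎
  where
  open ≡-Reasoning
  term : Cube (suc n) → ℕ
  term x = α ^ dist x (b ∷ a) * β ^ (suc n ∸ dist x (b ∷ a))
  term₀ : Cube n → ℕ
  term₀ v = α ^ dist v a * β ^ (n ∸ dist v a)
  far : ∀ v → α ^ suc (dist v a) * β ^ (suc n ∸ suc (dist v a)) ≡ α * term₀ v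
  far v = *-assoc α _ _
  near : ∀ v → α ^ dist v a * β ^ (suc n ∸ dist v a) ≡ β * term₀ v
  near v = begin
    α ^ dist v a * β ^ (suc n ∸ dist v a)   ≡⟨ cong (λ e → α ^ dist v a * β ^ e) (+-∸-assoc 1 (dist≤n v a)) ⟩
    α ^ dist v a * (β * β ^ (n ∸ dist v a)) ≡⟨ x∙yz≈y∙xz (α ^ dist v a) β _ ⟩
    β * term₀ v                             ∎
  neighbours : ∀ b′ v → α ^ dist (false ∷ v) (b′ ∷ a) * β ^ (suc n ∸ dist (false ∷ v) (b′ ∷ a))
                       + α ^ dist (true ∷ v) (b′ ∷ a) * β ^ (suc n ∸ dist (true ∷ v) (b′ ∷ a))
                       ≡ (α + β) * term₀ v
  neighbours false v = trans (cong₂ _+_ (near v) (far v))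
                         (trans (+-comm (β * term₀ v) _) (sym (*-distribʳ-+ (term₀ v) α β)))
  neighbours true  v = trans (cong₂ _+_ (far v) (near v)) (sym (*-distribʳ-+ (term₀ v) α β))

cubeSum-sum-comm : ∀ n {B : Set} (h : Cube n → B → ℕ) (bs : List B) →
                   cubeSum n (λ x → sum (map (h x) bs)) ≡ sum (map (λ b → cubeSum n (λ x → h x b)) bs)
cubeSum-sum-comm n h []       = trans (cubeSum-const n 0) (*-zeroˡ (2 ^ n))
cubeSum-sum-comm n h (b ∷ bs) = trans (sum-map-+ (λ x → h x b) (λ x → sum (map (h x) bs)) (allPoints n))
                                  (cong (cubeSum n (λ x → h x b) +_) (cubeSum-sum-comm n h bs))

-- Every coordinate contributes 1 to exactly half of the distances.
cubeSum-dist : ∀ n (a : Cube n) → 2 * cubeSum n (λ x → dist x a) ≡ n * 2 ^ n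
cubeSum-dist zero    []      = refl
cubeSum-dist (suc n) (b ∷ a) = begin
    2 * cubeSum (suc n) (λ x → dist x (b ∷ a))
      ≡⟨ cong (2 *_) (cubeSum-suc n (λ x → dist x (b ∷ a))) ⟩
    2 * cubeSum n (λ v → dist (false ∷ v) (b ∷ a) + dist (true ∷ v) (b ∷ a))
      ≡⟨ cong (2 *_) (cong sum (map-cong (neighbours b) (allPoints n))) ⟩
    2 * cubeSum n (λ v → 1 + 2 * dist v a)
      ≡⟨ cong (2 *_) (sum-map-+ (λ _ → 1) (λ v → 2 * dist v a) (allPoints n)) ⟩
    2 * (cubeSum n (λ _ → 1) + cubeSum n (λ v → 2 * dist v a))
      ≡⟨ cong₂ (λ p q → 2 * (p + q)) (cubeSum-const n 1) (sum-map-*ˡ 2 (λ v → dist v a) (allPoints n)) ⟩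
    2 * (1 * 2 ^ n + 2 * cubeSum n (λ v → dist v a))
      ≡⟨ cong (λ s → 2 * (1 * 2 ^ n + s)) (cubeSum-dist n a) ⟩
    2 * (1 * 2 ^ n + n * 2 ^ n)
      ≡⟨ regroup n (2 ^ n) ⟩
    suc n * 2 ^ suc n ∎
  where
  open ≡-Reasoning
  regroup : ∀ n N → 2 * (1 * N + n * N) ≡ suc n * (2 * N)
  regroup = solve-∀
  one+2d : ∀ d → d + suc d ≡ 1 + 2 * d
  one+2d = solve-∀
  neighbours : ∀ b′ v → dist (false ∷ v) (b′ ∷ a) + dist (true ∷ v) (b′ ∷ a) ≡ 1 + 2 * dist v a
  neighbours false v = one+2d (dist v a)
  neighbours true  v = trans (+-comm (suc (dist v a)) (dist v a)) (one+2d (dist v a))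

-- Distance to a set

∈-allPoints : ∀ {n} (x : Cube n) → x ∈ allPoints n
∈-allPoints []                = here refl
∈-allPoints {suc n} (b ∷ x)   = go b (allPoints n) (∈-allPoints x)
  where
  go : ∀ b vs → x ∈ vs → (b ∷ x) ∈ concatMap (λ v → (false ∷ v) ∷ (true ∷ v) ∷ []) vs
  go false (v ∷ vs) (here refl) = here refl
  go true  (v ∷ vs) (here refl) = there (here refl)
  go b     (v ∷ vs) (there x∈vs) = there (there (go b vs x∈vs))

∈-elems⁺ : ∀ {n} (A : SubsetC n) {a} → A a ≡ true → a ∈ elems A
∈-elems⁺ A {a} a∈A = ∈-filter⁺ (λ x → A x ≟ᵇ true) (∈-allPoints a) a∈A

∈-elems⁻ : ∀ {n} (A : SubsetC n) {a} → a ∈ elems A → A a ≡ true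
∈-elems⁻ {n} A a∈A = proj₂ (∈-filter⁻ (λ x → A x ≟ᵇ true) {xs = allPoints n} a∈A)

module _ {B : Set} (g : B → ℕ) (top : ℕ) where

  foldr-⊓ : List B → ℕ
  foldr-⊓ = foldr (λ b m → g b ⊓ m) top

  foldr-⊓≤ : ∀ {b} bs → b ∈ bs → foldr-⊓ bs ≤ g b
  foldr-⊓≤ (c ∷ bs) (here refl)  = m⊓n≤m (g c) _
  foldr-⊓≤ (c ∷ bs) (there b∈bs) = ≤-trans (m⊓n≤n (g c) _) (foldr-⊓≤ bs b∈bs)

  foldr-⊓≤top : ∀ bs → foldr-⊓ bs ≤ top
  foldr-⊓≤top []       = ≤-refl
  foldr-⊓≤top (c ∷ bs) = ≤-trans (m⊓n≤n (g c) _) (foldr-⊓≤top bs)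

  foldr-⊓-sel : ∀ bs → foldr-⊓ bs ≡ top ⊎ ∃ λ b → b ∈ bs × foldr-⊓ bs ≡ g b
  foldr-⊓-sel []       = inj₁ refl
  foldr-⊓-sel (c ∷ bs) with ⊓-sel (g c) (foldr-⊓ bs)
  ... | inj₁ eq = inj₂ (c , here refl , eq)
  ... | inj₂ eq with foldr-⊓-sel bs
  ...   | inj₁ eq′             = inj₁ (trans eq eq′)
  ...   | inj₂ (b , b∈bs , eq′) = inj₂ (b , there b∈bs , trans eq eq′)

  foldr-⊓-attained : (∀ b → g b ≤ top) → ∀ bs {b₀} → b₀ ∈ bs → ∃ λ b → b ∈ bs × foldr-⊓ bs ≡ g b
  foldr-⊓-attained g≤top bs {b₀} b₀∈bs with foldr-⊓-sel bs
  ... | inj₂ attained = attained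
  ... | inj₁ eq       = b₀ , b₀∈bs , ≤-antisym (foldr-⊓≤ bs b₀∈bs) (subst (g b₀ ≤_) (sym eq) (g≤top b₀))

distSet≤dist : ∀ {n} (x : Cube n) (A : SubsetC n) {a} → A a ≡ true → distSet x A ≤ dist x a
distSet≤dist {n} x A a∈A = foldr-⊓≤ (dist x) n (elems A) (∈-elems⁺ A a∈A)

distSet≤n : ∀ {n} (x : Cube n) (A : SubsetC n) → distSet x A ≤ n
distSet≤n {n} x A = foldr-⊓≤top (dist x) n (elems A)

distSet-attained : ∀ {n} (x : Cube n) (A : SubsetC n) → NonEmpty A →
                   ∃ λ a → a ∈ elems A × distSet x A ≡ dist x a
distSet-attained {n} x A (a , a∈A) = foldr-⊓-attained (dist x) n (dist≤n x) (elems A) (∈-elems⁺ A a∈A)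

card>0 : ∀ {n} (A : SubsetC n) → NonEmpty A → 0 < card A
card>0 A (a , a∈A) with elems A | ∈-elems⁺ A a∈A
... | _ ∷ _ | _ = z<s

NonEmpty⊎card≡0 : ∀ {n} (A : SubsetC n) → NonEmpty A ⊎ card A ≡ 0
NonEmpty⊎card≡0 A with elems A in eq
... | []    = inj₂ refl
... | a ∷ _ = inj₁ (a , ∈-elems⁻ A (subst (a ∈_) (sym eq) (here refl)))

totalDist-bound : ∀ {n} (A : SubsetC n) → NonEmpty A → 2 * totalDist A ≤ n * 2 ^ n
totalDist-bound {n} A (a , a∈A) = begin
    2 * totalDist A                  ≤⟨ *-monoʳ-≤ 2 (sum-map-mono (allPoints n) (λ x → distSet≤dist x A a∈A)) ⟩
    2 * cubeSum n (λ x → dist x a)   ≡⟨ cubeSum-dist n a ⟩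
    n * 2 ^ n                        ∎
  where open ≤-Reasoning

-- The factor card A makes this hold also for empty A, whose totalDist is n 2^n.
card*totalDist-bound : ∀ {n} (A : SubsetC n) → card A * (2 * totalDist A) ≤ card A * (n * 2 ^ n)
card*totalDist-bound {n} A with NonEmpty⊎card≡0 A
... | inj₁ nonEmpty = *-monoʳ-≤ (card A) (totalDist-bound A nonEmpty)
... | inj₂ card≡0   = subst (λ c → c * (2 * totalDist A) ≤ c * (n * 2 ^ n)) (sym card≡0) z≤n

card-lowerBound : ∀ n (A : SubsetC n) → NonEmpty A →
  2 ^ (n * 2 ^ n) * (totalDist A ^ totalDist A * (n * 2 ^ n ∸ totalDist A) ^ (n * 2 ^ n ∸ totalDist A))
    ≤ (card A * (n * 2 ^ n) ^ n) ^ 2 ^ n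
card-lowerBound n A nonEmpty = begin
    2 ^ r * (S ^ S * T ^ T)        ≡⟨ cong (2 ^ r *_) product-weights ⟨
    2 ^ r * cubeProduct n weight   ≤⟨ cube-amgm n weight ⟩
    cubeSum n weight ^ 2 ^ n       ≤⟨ ^-monoˡ-≤ (2 ^ n) sum-weights ⟩
    (card A * r ^ n) ^ 2 ^ n       ∎
  where
  open ≤-Reasoning
  S = totalDist A
  r = n * 2 ^ n
  T = r ∸ S
  d : Cube n → ℕ
  d x = distSet x A
  weight : Cube n → ℕ
  weight x = S ^ d x * T ^ (n ∸ d x)
  weightTo : Cube n → Cube n → ℕ
  weightTo x a = S ^ dist x a * T ^ (n ∸ dist x a)
  S+codist : cubeSum n (λ x → n ∸ d x) + S ≡ r
  S+codist = begin-equality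
    cubeSum n (λ x → n ∸ d x) + S       ≡⟨ sum-map-+ (λ x → n ∸ d x) d (allPoints n) ⟨
    cubeSum n (λ x → n ∸ d x + d x)     ≡⟨ cong sum (map-cong (λ x → m∸n+n≡m (distSet≤n x A)) (allPoints n)) ⟩
    cubeSum n (λ _ → n)                 ≡⟨ cubeSum-const n n ⟩
    r                                   ∎
  S≤r : S ≤ r
  S≤r = subst (S ≤_) S+codist (m≤n+m S _)
  product-weights : cubeProduct n weight ≡ S ^ S * T ^ T
  product-weights = trans (product-map-* (λ x → S ^ d x) (λ x → T ^ (n ∸ d x)) (allPoints n))
    (cong₂ _*_ (product-map-^ S d (allPoints n))
      (trans (product-map-^ T (λ x → n ∸ d x) (allPoints n))
        (cong (T ^_) (trans (sym (m+n∸n≡m _ S)) (cong (_∸ S) S+codist)))))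
  weight≤ : ∀ x → weight x ≤ sum (map (weightTo x) (elems A))
  weight≤ x with distSet-attained x A nonEmpty
  ... | a , a∈A , d≡ = subst (_≤ sum (map (weightTo x) (elems A))) (cong (λ k → S ^ k * T ^ (n ∸ k)) (sym d≡))
                         (∈⇒≤sum-map (weightTo x) a∈A)
  sum-weights : cubeSum n weight ≤ card A * r ^ n
  sum-weights = begin
    cubeSum n weight                                         ≤⟨ sum-map-mono (allPoints n) weight≤ ⟩
    cubeSum n (λ x → sum (map (weightTo x) (elems A)))       ≡⟨ cubeSum-sum-comm n weightTo (elems A) ⟩
    sum (map (λ a → cubeSum n (λ x → weightTo x a)) (elems A)) ≡⟨ cong sum (map-cong (cubeSum-binomial S T n) (elems A)) ⟩
    sum (map (λ _ → (S + T) ^ n) (elems A))                  ≡⟨ sum-map-const ((S + T) ^ n) (elems A) ⟩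
    card A * (S + T) ^ n                                     ≡⟨ cong (λ k → card A * k ^ n) (m+[n∸m]≡n S≤r) ⟩
    card A * r ^ n                                           ∎

-- Facets and the upper bound

facet : ∀ {n} → SubsetC (suc n) → Bool → SubsetC n
facet A b v = A (b ∷ v)

indicator : Bool → ℕ
indicator true  = 1
indicator false = 0

card≡cubeSum : ∀ {n} (A : SubsetC n) → card A ≡ cubeSum n (λ x → indicator (A x))
card≡cubeSum {n} A = go (allPoints n)
  where
  go : ∀ xs → length (filter (λ x → A x ≟ᵇ true) xs) ≡ sum (map (λ x → indicator (A x)) xs)
  go []       = refl
  go (x ∷ xs) with A x
  ... | true  = cong suc (go xs)
  ... | false = go xs

card-facets : ∀ {n} (A : SubsetC (suc n)) b → card A ≡ card (facet A (not b)) + card (facet A b)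
card-facets {n} A b = begin
    card A                                    ≡⟨ card≡cubeSum A ⟩
    cubeSum (suc n) (λ x → indicator (A x))   ≡⟨ cubeSum-suc n (λ x → indicator (A x)) ⟩
    cubeSum n (λ v → indicator (A (false ∷ v)) + indicator (A (true ∷ v)))
      ≡⟨ sum-map-+ (λ v → indicator (A (false ∷ v))) (λ v → indicator (A (true ∷ v))) (allPoints n) ⟩
    card₀ + card₁                             ≡⟨ ordered b ⟩
    card (facet A (not b)) + card (facet A b) ∎
  where
  open ≡-Reasoning
  card₀ = cubeSum n (λ v → indicator (A (false ∷ v)))
  card₁ = cubeSum n (λ v → indicator (A (true ∷ v)))
  ordered : ∀ b → card₀ + card₁ ≡ card (facet A (not b)) + card (facet A b)
  ordered true  = sym (cong₂ _+_ (card≡cubeSum (facet A false)) (card≡cubeSum (facet A true)))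
  ordered false = trans (+-comm card₀ card₁) (sym (cong₂ _+_ (card≡cubeSum (facet A true)) (card≡cubeSum (facet A false))))

larger-facet-nonEmpty : ∀ {n} (A : SubsetC (suc n)) b → NonEmpty A →
                        card (facet A (not b)) ≤ card (facet A b) → NonEmpty (facet A b)
larger-facet-nonEmpty A b nonEmpty smaller≤ with NonEmpty⊎card≡0 (facet A b)
... | inj₁ nonEmptyᵇ = nonEmptyᵇ
... | inj₂ card≡0    = contradiction card-A≡0 (>⇒≢ (card>0 A nonEmpty))
  where
  card-A≡0 : card A ≡ 0
  card-A≡0 = trans (card-facets A b) (cong₂ _+_ (n≤0⇒n≡0 (subst (card (facet A (not b)) ≤_) card≡0 smaller≤)) card≡0)

larger-facet : ∀ {n} (A : SubsetC (suc n)) → NonEmpty A →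
               ∃ λ b → NonEmpty (facet A b) × card (facet A (not b)) ≤ card (facet A b)
larger-facet A nonEmpty with ≤-total (card (facet A true)) (card (facet A false))
... | inj₁ ≤false = false , larger-facet-nonEmpty A false nonEmpty ≤false , ≤false
... | inj₂ ≤true  = true  , larger-facet-nonEmpty A true  nonEmpty ≤true  , ≤true

distSet-cons≤ : ∀ {n} (A : SubsetC (suc n)) b′ b (v : Cube n) → NonEmpty (facet A b) →
                distSet (b′ ∷ v) A ≤ bitDist b′ b + distSet v (facet A b)
distSet-cons≤ A b′ b v nonEmpty with distSet-attained v (facet A b) nonEmpty
... | a , a∈A , d≡ = ≤-trans (distSet≤dist (b′ ∷ v) A (∈-elems⁻ (facet A b) a∈A))
                              (≤-reflexive (cong (bitDist b′ b +_) (sym d≡)))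

totalDist-facets : ∀ {n} (A : SubsetC (suc n)) b →
                   totalDist A ≡ cubeSum n (λ v → distSet (b ∷ v) A + distSet (not b ∷ v) A)
totalDist-facets {n} A false = cubeSum-suc n (λ x → distSet x A)
totalDist-facets {n} A true  = trans (cubeSum-suc n (λ x → distSet x A))
                                 (cong sum (map-cong (λ v → +-comm (distSet (false ∷ v) A) _) (allPoints n)))

cubeSum-affine : ∀ n a c (f : Cube n → ℕ) → cubeSum n (λ v → a * f v + c) ≡ a * cubeSum n f + c * 2 ^ n
cubeSum-affine n a c f = trans (sum-map-+ (λ v → a * f v) (λ _ → c) (allPoints n))
                           (cong₂ _+_ (sum-map-*ˡ a f (allPoints n)) (cubeSum-const n c))

cubeSum-affine₂ : ∀ n a b c (f g : Cube n → ℕ) →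
                  cubeSum n (λ v → a * f v + b * g v + c) ≡ a * cubeSum n f + b * cubeSum n g + c * 2 ^ n
cubeSum-affine₂ n a b c f g = trans (sum-map-+ (λ v → a * f v + b * g v) (λ _ → c) (allPoints n))
  (cong₂ _+_ (trans (sum-map-+ (λ v → a * f v) (λ v → b * g v) (allPoints n))
                    (cong₂ _+_ (sum-map-*ˡ a f (allPoints n)) (sum-map-*ˡ b g (allPoints n))))
             (cubeSum-const n c))

-- dₛ is bounded by eₛ with weight 2Xₛ and by 1 + eₗ with the remaining weight D = Xₗ - Xₛ.
split-pointwise : ∀ Xₛ D dₗ dₛ eₗ eₛ → dₗ ≤ eₗ → dₛ ≤ 1 + eₗ → Xₛ * dₛ ≤ Xₛ * eₛ →
                  (Xₛ + (Xₛ + D)) * (dₗ + dₛ) + Xₛ ≤ 2 * Xₛ * eₛ + 2 * (Xₛ + D) * eₗ + (Xₛ + D)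
split-pointwise Xₛ D dₗ dₛ eₗ eₛ dₗ≤ dₛ≤ Xₛdₛ≤ = begin
    (Xₛ + (Xₛ + D)) * (dₗ + dₛ) + Xₛ                   ≡⟨ expand Xₛ D dₗ dₛ ⟩
    (Xₛ + (Xₛ + D)) * dₗ + 2 * (Xₛ * dₛ) + D * dₛ + Xₛ
      ≤⟨ +-monoˡ-≤ Xₛ (+-mono-≤ (+-mono-≤ (*-monoʳ-≤ (Xₛ + (Xₛ + D)) dₗ≤) (*-monoʳ-≤ 2 Xₛdₛ≤))
                                 (*-monoʳ-≤ D dₛ≤)) ⟩
    (Xₛ + (Xₛ + D)) * eₗ + 2 * (Xₛ * eₛ) + D * (1 + eₗ) + Xₛ ≡⟨ collect Xₛ D eₗ eₛ ⟩
    2 * Xₛ * eₛ + 2 * (Xₛ + D) * eₗ + (Xₛ + D)         ∎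
  where
  open ≤-Reasoning
  expand : ∀ Xₛ D dₗ dₛ → (Xₛ + (Xₛ + D)) * (dₗ + dₛ) + Xₛ
                          ≡ (Xₛ + (Xₛ + D)) * dₗ + 2 * (Xₛ * dₛ) + D * dₛ + Xₛ
  expand = solve-∀
  collect : ∀ Xₛ D eₗ eₛ → (Xₛ + (Xₛ + D)) * eₗ + 2 * (Xₛ * eₛ) + D * (1 + eₗ) + Xₛ
                           ≡ 2 * Xₛ * eₛ + 2 * (Xₛ + D) * eₗ + (Xₛ + D)
  collect = solve-∀

totalDist-split : ∀ {n} (A : SubsetC (suc n)) b → NonEmpty (facet A b) → card (facet A (not b)) ≤ card (facet A b) →
  (card (facet A (not b)) + card (facet A b)) * totalDist A + card (facet A (not b)) * 2 ^ n
    ≤ 2 * card (facet A (not b)) * totalDist (facet A (not b)) + 2 * card (facet A b) * totalDist (facet A b)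
      + card (facet A b) * 2 ^ n
totalDist-split {n} A b nonEmptyₗ Xₛ≤Xₗ = begin
    (Xₛ + Xₗ) * totalDist A + Xₛ * 2 ^ n
      ≡⟨ cong (λ t → (Xₛ + Xₗ) * t + Xₛ * 2 ^ n) (totalDist-facets A b) ⟩
    (Xₛ + Xₗ) * cubeSum n (λ v → dₗ v + dₛ v) + Xₛ * 2 ^ n
      ≡⟨ cubeSum-affine n (Xₛ + Xₗ) Xₛ (λ v → dₗ v + dₛ v) ⟨
    cubeSum n (λ v → (Xₛ + Xₗ) * (dₗ v + dₛ v) + Xₛ)
      ≤⟨ sum-map-mono (allPoints n) pointwise ⟩
    cubeSum n (λ v → 2 * Xₛ * eₛ v + 2 * Xₗ * eₗ v + Xₗ)
      ≡⟨ cubeSum-affine₂ n (2 * Xₛ) (2 * Xₗ) Xₗ eₛ eₗ ⟩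
    2 * Xₛ * totalDist Aₛ + 2 * Xₗ * totalDist Aₗ + Xₗ * 2 ^ n ∎
  where
  open ≤-Reasoning
  Aₛ = facet A (not b)
  Aₗ = facet A b
  Xₛ = card Aₛ
  Xₗ = card Aₗ
  dₗ dₛ eₗ eₛ : Cube n → ℕ
  dₗ v = distSet (b ∷ v) A
  dₛ v = distSet (not b ∷ v) A
  eₗ v = distSet v Aₗ
  eₛ v = distSet v Aₛ
  dₗ≤eₗ : ∀ v → dₗ v ≤ eₗ v
  dₗ≤eₗ v = subst (λ k → dₗ v ≤ k + eₗ v) (bitDist-self b) (distSet-cons≤ A b b v nonEmptyₗ)
  dₛ≤1+eₗ : ∀ v → dₛ v ≤ 1 + eₗ v
  dₛ≤1+eₗ v = subst (λ k → dₛ v ≤ k + eₗ v) (bitDist-not b) (distSet-cons≤ A (not b) b v nonEmptyₗ)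
  Xₛdₛ≤Xₛeₛ : ∀ v → Xₛ * dₛ v ≤ Xₛ * eₛ v
  Xₛdₛ≤Xₛeₛ v with NonEmpty⊎card≡0 Aₛ
  ... | inj₁ nonEmptyₛ = *-monoʳ-≤ Xₛ (subst (λ k → dₛ v ≤ k + eₛ v) (bitDist-self (not b))
                                               (distSet-cons≤ A (not b) (not b) v nonEmptyₛ))
  ... | inj₂ card≡0    = subst (λ c → c * dₛ v ≤ c * eₛ v) (sym card≡0) z≤n
  pointwise : ∀ v → (Xₛ + Xₗ) * (dₗ v + dₛ v) + Xₛ ≤ 2 * Xₛ * eₛ v + 2 * Xₗ * eₗ v + Xₗ
  pointwise v with m≤n⇒∃[o]m+o≡n Xₛ≤Xₗ
  ... | D , Xₛ+D≡Xₗ = subst (λ X → (Xₛ + X) * (dₗ v + dₛ v) + Xₛ ≤ 2 * Xₛ * eₛ v + 2 * X * eₗ v + X) Xₛ+D≡Xₗ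
                        (split-pointwise Xₛ D (dₗ v) (dₛ v) (eₗ v) (eₛ v) (dₗ≤eₗ v) (dₛ≤1+eₗ v) (Xₛdₛ≤Xₛeₛ v))

-- For N = 2^n, X = |A| and S = totalDist A this says log₂ |A| ≤ n H(ρ) with ρ = (n N - 2 S) / (2 n N).
CubeBound : ℕ → ℕ → ℕ → ℕ → Set
CubeBound n N X S = EntropyBound (X ^ (2 * N)) 1 (n * N ∸ 2 * S) (n * N + 2 * S)

*[∸]+*≡* : ∀ x {a b} → x * b ≤ x * a → x * (a ∸ b) + x * b ≡ x * a
*[∸]+*≡* x {a} {b} xb≤xa = trans (cong (_+ x * b) (*-distribˡ-∸ x a b)) (m∸n+n≡m xb≤xa)

step-exponents≤ : ∀ n N {Xₛ Xₗ Sₛ Sₗ S Kₛ Kₗ K} →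
  Xₛ * Kₛ + Xₛ * (2 * Sₛ) ≡ Xₛ * (n * N) → Xₗ * Kₗ + Xₗ * (2 * Sₗ) ≡ Xₗ * (n * N) →
  K + 2 * S ≡ suc n * (2 * N) →
  (Xₛ + Xₗ) * S + Xₛ * N ≤ 2 * Xₛ * Sₛ + 2 * Xₗ * Sₗ + Xₗ * N →
  2 * Xₛ * Kₛ + 2 * Xₗ * Kₗ + 2 * (2 * N) * Xₛ ≤ (Xₛ + Xₗ) * K
step-exponents≤ n N {Xₛ} {Xₗ} {Sₛ} {Sₗ} {S} {Kₛ} {Kₗ} {K} eqₛ eqₗ eq split =
  +-cancelʳ-≤ (2 * ((Xₛ + Xₗ) * S + Xₛ * N)) _ _ (begin
    U + 2 * ((Xₛ + Xₗ) * S + Xₛ * N)          ≤⟨ +-monoʳ-≤ U (*-monoʳ-≤ 2 split) ⟩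
    U + 2 * (2 * Xₛ * Sₛ + 2 * Xₗ * Sₗ + Xₗ * N)  ≡⟨ regroup₁ Xₛ Xₗ Sₛ Sₗ Kₛ Kₗ N ⟩
    2 * (Xₛ * Kₛ + Xₛ * (2 * Sₛ)) + 2 * (Xₗ * Kₗ + Xₗ * (2 * Sₗ)) + (4 * N * Xₛ + 2 * Xₗ * N)
      ≡⟨ cong₂ (λ p q → 2 * p + 2 * q + (4 * N * Xₛ + 2 * Xₗ * N)) eqₛ eqₗ ⟩
    2 * (Xₛ * (n * N)) + 2 * (Xₗ * (n * N)) + (4 * N * Xₛ + 2 * Xₗ * N)  ≡⟨ regroup₂ n N Xₛ Xₗ ⟩
    (Xₛ + Xₗ) * (suc n * (2 * N)) + 2 * (Xₛ * N)  ≡⟨ cong (λ k → (Xₛ + Xₗ) * k + 2 * (Xₛ * N)) eq ⟨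
    (Xₛ + Xₗ) * (K + 2 * S) + 2 * (Xₛ * N)        ≡⟨ regroup₃ Xₛ Xₗ K S N ⟩
    (Xₛ + Xₗ) * K + 2 * ((Xₛ + Xₗ) * S + Xₛ * N)  ∎)
  where
  open ≤-Reasoning
  U = 2 * Xₛ * Kₛ + 2 * Xₗ * Kₗ + 2 * (2 * N) * Xₛ
  regroup₁ : ∀ Xₛ Xₗ Sₛ Sₗ Kₛ Kₗ N →
    2 * Xₛ * Kₛ + 2 * Xₗ * Kₗ + 2 * (2 * N) * Xₛ + 2 * (2 * Xₛ * Sₛ + 2 * Xₗ * Sₗ + Xₗ * N)
    ≡ 2 * (Xₛ * Kₛ + Xₛ * (2 * Sₛ)) + 2 * (Xₗ * Kₗ + Xₗ * (2 * Sₗ)) + (4 * N * Xₛ + 2 * Xₗ * N)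
  regroup₁ = solve-∀
  regroup₂ : ∀ n N Xₛ Xₗ → 2 * (Xₛ * (n * N)) + 2 * (Xₗ * (n * N)) + (4 * N * Xₛ + 2 * Xₗ * N)
                           ≡ (Xₛ + Xₗ) * (suc n * (2 * N)) + 2 * (Xₛ * N)
  regroup₂ = solve-∀
  regroup₃ : ∀ Xₛ Xₗ K S N → (Xₛ + Xₗ) * (K + 2 * S) + 2 * (Xₛ * N) ≡ (Xₛ + Xₗ) * K + 2 * ((Xₛ + Xₗ) * S + Xₛ * N)
  regroup₃ = solve-∀

step-exponents≡ : ∀ n N {Xₛ Xₗ Sₛ Sₗ S Kₛ Kₗ K} →
  Xₛ * Kₛ + Xₛ * (2 * Sₛ) ≡ Xₛ * (n * N) → Xₗ * Kₗ + Xₗ * (2 * Sₗ) ≡ Xₗ * (n * N) →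
  K + 2 * S ≡ suc n * (2 * N) →
  (Xₛ + Xₗ) * K + (Xₛ + Xₗ) * (suc n * (2 * N) + 2 * S)
    ≡ 2 * Xₛ * Kₛ + 2 * Xₗ * Kₗ + 2 * (2 * N) * Xₛ
      + (2 * Xₛ * (n * N + 2 * Sₛ) + 2 * Xₗ * (n * N + 2 * Sₗ) + 2 * (2 * N) * Xₗ)
step-exponents≡ n N {Xₛ} {Xₗ} {Sₛ} {Sₗ} {S} {Kₛ} {Kₗ} {K} eqₛ eqₗ eq = begin
    (Xₛ + Xₗ) * K + (Xₛ + Xₗ) * (suc n * (2 * N) + 2 * S) ≡⟨ regroup₁ (Xₛ + Xₗ) K S (suc n * (2 * N)) ⟩
    (Xₛ + Xₗ) * (K + 2 * S) + (Xₛ + Xₗ) * (suc n * (2 * N))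
      ≡⟨ cong (λ k → (Xₛ + Xₗ) * k + (Xₛ + Xₗ) * (suc n * (2 * N))) eq ⟩
    (Xₛ + Xₗ) * (suc n * (2 * N)) + (Xₛ + Xₗ) * (suc n * (2 * N)) ≡⟨ regroup₂ n N Xₛ Xₗ ⟩
    2 * (Xₛ * (n * N)) + 2 * (Xₗ * (n * N)) + 2 * Xₛ * (n * N) + 2 * Xₗ * (n * N) + 2 * (2 * N) * (Xₛ + Xₗ)
      ≡⟨ cong₂ (λ p q → 2 * p + 2 * q + 2 * Xₛ * (n * N) + 2 * Xₗ * (n * N) + 2 * (2 * N) * (Xₛ + Xₗ)) eqₛ eqₗ ⟨
    2 * (Xₛ * Kₛ + Xₛ * (2 * Sₛ)) + 2 * (Xₗ * Kₗ + Xₗ * (2 * Sₗ)) + 2 * Xₛ * (n * N) + 2 * Xₗ * (n * N)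
      + 2 * (2 * N) * (Xₛ + Xₗ)                           ≡⟨ regroup₃ Xₛ Xₗ Sₛ Sₗ Kₛ Kₗ (n * N) N ⟩
    2 * Xₛ * Kₛ + 2 * Xₗ * Kₗ + 2 * (2 * N) * Xₛ
      + (2 * Xₛ * (n * N + 2 * Sₛ) + 2 * Xₗ * (n * N + 2 * Sₗ) + 2 * (2 * N) * Xₗ) ∎
  where
  open ≡-Reasoning
  regroup₁ : ∀ X K S m → X * K + X * (m + 2 * S) ≡ X * (K + 2 * S) + X * m
  regroup₁ = solve-∀
  regroup₂ : ∀ n N Xₛ Xₗ → (Xₛ + Xₗ) * (suc n * (2 * N)) + (Xₛ + Xₗ) * (suc n * (2 * N))
             ≡ 2 * (Xₛ * (n * N)) + 2 * (Xₗ * (n * N)) + 2 * Xₛ * (n * N) + 2 * Xₗ * (n * N) + 2 * (2 * N) * (Xₛ + Xₗ)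
  regroup₂ = solve-∀
  regroup₃ : ∀ Xₛ Xₗ Sₛ Sₗ Kₛ Kₗ m N →
    2 * (Xₛ * Kₛ + Xₛ * (2 * Sₛ)) + 2 * (Xₗ * Kₗ + Xₗ * (2 * Sₗ)) + 2 * Xₛ * m + 2 * Xₗ * m + 2 * (2 * N) * (Xₛ + Xₗ)
    ≡ 2 * Xₛ * Kₛ + 2 * Xₗ * Kₗ + 2 * (2 * N) * Xₛ + (2 * Xₛ * (m + 2 * Sₛ) + 2 * Xₗ * (m + 2 * Sₗ) + 2 * (2 * N) * Xₗ)
  regroup₃ = solve-∀

^-comm : ∀ x a b → (x ^ a) ^ b ≡ (x ^ b) ^ a
^-comm x a b = trans (^-*-assoc x a b) (trans (cong (x ^_) (*-comm a b)) (sym (^-*-assoc x b a)))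

-- Raise the facet bounds to the powers 2Xₛ, 2Xₗ and chain them with the exact split of |A|^|A|
-- into Xₛ^Xₛ Xₗ^Xₗ; this bounds |A|^(4N|A|), and balancing the exponents and taking the |A|-th root
-- gives the bound in dimension n + 1.
cubeBound-step : ∀ n N {Xₛ Xₗ Sₛ Sₗ S} → 0 < Xₛ + Xₗ →
  CubeBound n N Xₛ Sₛ → CubeBound n N Xₗ Sₗ →
  Xₛ * (2 * Sₛ) ≤ Xₛ * (n * N) → Xₗ * (2 * Sₗ) ≤ Xₗ * (n * N) →
  (Xₛ + Xₗ) * S + Xₛ * N ≤ 2 * Xₛ * Sₛ + 2 * Xₗ * Sₗ + Xₗ * N → 2 * S ≤ suc n * (2 * N) →
  CubeBound (suc n) (2 * N) (Xₛ + Xₗ) S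
cubeBound-step n N {Xₛ} {Xₗ} {Sₛ} {Sₗ} {S} X>0 boundₛ boundₗ Sₛ≤ Sₗ≤ split S≤ =
  entropyBound-root X X>0
    (subst₂ (λ W D → EntropyBound W D (X * K) (X * V)) (^-comm X X M) (sym (^-zeroˡ X))
      (entropyBound-balance (step-exponents≤ n N eqₛ eqₗ eq split)
        (*-monoʳ-≤ X K≤V) (step-exponents≡ n N {Xₛ} {Xₗ} {Sₛ} {Sₗ} {S} {Kₛ} {Kₗ} {K} eqₛ eqₗ eq) mixed))
  where
  X = Xₛ + Xₗ
  M = 2 * (2 * N)
  Kₛ = n * N ∸ 2 * Sₛ
  Kₗ = n * N ∸ 2 * Sₗ
  K = suc n * (2 * N) ∸ 2 * S
  V = suc n * (2 * N) + 2 * S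
  eqₛ : Xₛ * Kₛ + Xₛ * (2 * Sₛ) ≡ Xₛ * (n * N)
  eqₛ = *[∸]+*≡* Xₛ Sₛ≤
  eqₗ : Xₗ * Kₗ + Xₗ * (2 * Sₗ) ≡ Xₗ * (n * N)
  eqₗ = *[∸]+*≡* Xₗ Sₗ≤
  eq : K + 2 * S ≡ suc n * (2 * N)
  eq = m∸n+n≡m S≤
  K≤V : K ≤ V
  K≤V = ≤-trans (m∸n≤m _ (2 * S)) (m≤m+n _ (2 * S))
  self^M : ∀ x → (x ^ (2 * N)) ^ (2 * x) ≡ (x ^ x) ^ M
  self^M x = trans (^-*-assoc x (2 * N) (2 * x))
               (trans (cong (x ^_) (exponent N x)) (sym (^-*-assoc x x M)))
    where
    exponent : ∀ N x → 2 * N * (2 * x) ≡ x * (2 * (2 * N))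
    exponent = solve-∀
  facets : EntropyBound ((Xₛ ^ Xₛ * Xₗ ^ Xₗ) ^ M) 1
                        (2 * Xₛ * Kₛ + 2 * Xₗ * Kₗ) (2 * Xₛ * (n * N + 2 * Sₛ) + 2 * Xₗ * (n * N + 2 * Sₗ))
  facets = subst₂ (λ W D → EntropyBound W D (2 * Xₛ * Kₛ + 2 * Xₗ * Kₗ)
                                             (2 * Xₛ * (n * N + 2 * Sₛ) + 2 * Xₗ * (n * N + 2 * Sₗ)))
             (trans (cong₂ _*_ (self^M Xₛ) (self^M Xₗ)) (sym (^-distribʳ-* (Xₛ ^ Xₛ) (Xₗ ^ Xₗ) M)))
             (cong₂ _*_ (^-zeroˡ (2 * Xₛ)) (^-zeroˡ (2 * Xₗ)))
             (entropyBound-* (entropyBound-^ (2 * Xₛ) boundₛ) (entropyBound-^ (2 * Xₗ) boundₗ))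
  mixed : EntropyBound ((X ^ X) ^ M) 1 (2 * Xₛ * Kₛ + 2 * Xₗ * Kₗ + M * Xₛ)
                       (2 * Xₛ * (n * N + 2 * Sₛ) + 2 * Xₗ * (n * N + 2 * Sₗ) + M * Xₗ)
  mixed = entropyBound-chain (m^n>0 (Xₛ ^ Xₛ * Xₗ ^ Xₗ) {{>-nonZero (*-mono-≤ (n^n>0 Xₛ) (n^n>0 Xₗ))}} M)
            facets (entropyBound-^ M (entropyBound-exact Xₛ Xₗ))

card-upperBound : ∀ n (A : SubsetC n) → CubeBound n (2 ^ n) (card A) (totalDist A)
card-upperBound n A with NonEmpty⊎card≡0 A
card-upperBound n       A | inj₂ card≡0 =
  subst (λ X → CubeBound n (2 ^ n) X (totalDist A)) (sym card≡0) (entropyBound-0^ (m^n>0 2 (suc n)))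
card-upperBound zero    A | inj₁ nonEmpty =
  subst (CubeBound 0 1 (card A)) (sym S≡0) (at-most-one (length-filter (λ x → A x ≟ᵇ true) (allPoints 0)))
  where
  at-most-one : ∀ {X} → X ≤ 1 → CubeBound 0 1 X 0
  at-most-one z≤n       = entropyBound z≤n
  at-most-one (s≤s z≤n) = entropyBound ≤-refl
  S≡0 : totalDist A ≡ 0
  S≡0 = n≤0⇒n≡0 (≤-trans (m≤n*m (totalDist A) 2) (totalDist-bound A nonEmpty))
card-upperBound (suc n) A | inj₁ nonEmpty with larger-facet A nonEmpty
... | b , nonEmptyₗ , Xₛ≤Xₗ =
  subst (λ X → CubeBound (suc n) (2 ^ suc n) X (totalDist A)) (sym (card-facets A b))
    (cubeBound-step n (2 ^ n) (subst (0 <_) (card-facets A b) (card>0 A nonEmpty))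
      (card-upperBound n (facet A (not b))) (card-upperBound n (facet A b))
      (card*totalDist-bound (facet A (not b))) (card*totalDist-bound (facet A b))
      (totalDist-split A b nonEmptyₗ Xₛ≤Xₗ) (totalDist-bound A nonEmpty))

monomial-^ : ∀ a i b j c k n → (a ^ i * (b ^ j * c ^ k)) ^ n ≡ a ^ (n * i) * b ^ (n * j) * c ^ (n * k)
monomial-^ a i b j c k n = begin
    (a ^ i * (b ^ j * c ^ k)) ^ n          ≡⟨ ^-distribʳ-* (a ^ i) (b ^ j * c ^ k) n ⟩
    (a ^ i) ^ n * (b ^ j * c ^ k) ^ n      ≡⟨ cong ((a ^ i) ^ n *_) (^-distribʳ-* (b ^ j) (c ^ k) n) ⟩
    (a ^ i) ^ n * ((b ^ j) ^ n * (c ^ k) ^ n)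
      ≡⟨ cong₂ _*_ ([m^n]^o≡m^[o*n] a i n)
               (cong₂ _*_ ([m^n]^o≡m^[o*n] b j n) ([m^n]^o≡m^[o*n] c k n)) ⟩
    a ^ (n * i) * (b ^ (n * j) * c ^ (n * k)) ≡⟨ *-assoc (a ^ (n * i)) _ _ ⟨
    a ^ (n * i) * b ^ (n * j) * c ^ (n * k) ∎
  where open ≡-Reasoning

lowerBound : ∀ n (A : SubsetC n) → NonEmpty A →
  2 ^ (n * (n * 2 ^ n)) * totalDist A ^ (n * totalDist A) * (n * 2 ^ n ∸ totalDist A) ^ (n * (n * 2 ^ n ∸ totalDist A))
    ≤ card A ^ (n * 2 ^ n) * (n * 2 ^ n) ^ (n * (n * 2 ^ n))
lowerBound n A nonEmpty = begin
    2 ^ (n * r) * S ^ (n * S) * T ^ (n * T) ≡⟨ monomial-^ 2 r S S T T n ⟨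
    (2 ^ r * (S ^ S * T ^ T)) ^ n           ≤⟨ ^-monoˡ-≤ n (card-lowerBound n A nonEmpty) ⟩
    ((X * r ^ n) ^ 2 ^ n) ^ n               ≡⟨ [m^n]^o≡m^[o*n] (X * r ^ n) (2 ^ n) n ⟩
    (X * r ^ n) ^ r                         ≡⟨ ^-distribʳ-* X (r ^ n) r ⟩
    X ^ r * (r ^ n) ^ r                     ≡⟨ cong (X ^ r *_) (^-*-assoc r n r) ⟩
    X ^ r * r ^ (n * r)                     ∎
  where
  open ≤-Reasoning
  X = card A
  S = totalDist A
  r = n * 2 ^ n
  T = r ∸ S

upperBound : ∀ n (A : SubsetC n) → NonEmpty A →
  card A ^ (2 * (n * 2 ^ n)) * (n * 2 ^ n ∸ 2 * totalDist A) ^ (n * (n * 2 ^ n ∸ 2 * totalDist A))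
    * (2 * (n * 2 ^ n) ∸ (n * 2 ^ n ∸ 2 * totalDist A)) ^ (n * (2 * (n * 2 ^ n) ∸ (n * 2 ^ n ∸ 2 * totalDist A)))
    ≤ (2 * (n * 2 ^ n)) ^ (n * (2 * (n * 2 ^ n)))
upperBound n A nonEmpty = begin
    X ^ s * K ^ (n * K) * (s ∸ K) ^ (n * (s ∸ K))   ≡⟨ cong (λ v → X ^ s * K ^ (n * K) * v ^ (n * v)) s∸K≡V ⟩
    X ^ s * K ^ (n * K) * V ^ (n * V)               ≡⟨ cong (λ e → X ^ e * K ^ (n * K) * V ^ (n * V)) (exponent n (2 ^ n)) ⟩
    X ^ (n * (2 * 2 ^ n)) * K ^ (n * K) * V ^ (n * V) ≡⟨ monomial-^ X (2 * 2 ^ n) K K V V n ⟨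
    (X ^ (2 * 2 ^ n) * (K ^ K * V ^ V)) ^ n          ≤⟨ ^-monoˡ-≤ n (EntropyBound.bound (card-upperBound n A)) ⟩
    (1 * (K + V) ^ (K + V)) ^ n                      ≡⟨ cong (_^ n) (*-identityˡ ((K + V) ^ (K + V))) ⟩
    ((K + V) ^ (K + V)) ^ n                          ≡⟨ cong (λ t → (t ^ t) ^ n) K+V≡s ⟩
    (s ^ s) ^ n                                      ≡⟨ [m^n]^o≡m^[o*n] s s n ⟩
    s ^ (n * s)                                      ∎
  where
  open ≤-Reasoning
  X = card A
  S = totalDist A
  r = n * 2 ^ n
  s = 2 * r
  K = r ∸ 2 * S
  V = r + 2 * S
  exponent : ∀ n N → 2 * (n * N) ≡ n * (2 * N)
  exponent = solve-∀
  K+V≡s : K + V ≡ s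
  K+V≡s = begin-equality
    K + (r + 2 * S)   ≡⟨ regroup K r (2 * S) ⟩
    K + 2 * S + r     ≡⟨ cong (_+ r) (m∸n+n≡m (totalDist-bound A nonEmpty)) ⟩
    r + r             ≡⟨ cong (r +_) (+-identityʳ r) ⟨
    2 * r             ∎
    where
    regroup : ∀ K r t → K + (r + t) ≡ K + t + r
    regroup = solve-∀
  s∸K≡V : s ∸ K ≡ V
  s∸K≡V = trans (cong (_∸ K) (sym K+V≡s)) (m+n∸m≡n K V)

-- The hypothesis n ≥ 1 is only needed to divide by n in the paper's formulation.
theorem3p9 : (n : ℕ) → n ≥ 1 → (A : SubsetC n) → NonEmpty A →
    (2 ^ (n * (n * 2 ^ n)) * totalDist A ^ (n * totalDist A)
        * (n * 2 ^ n ∸ totalDist A) ^ (n * (n * 2 ^ n ∸ totalDist A))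
      ≤ card A ^ (n * 2 ^ n) * (n * 2 ^ n) ^ (n * (n * 2 ^ n)))
    × (card A ^ (2 * (n * 2 ^ n)) * (n * 2 ^ n ∸ 2 * totalDist A) ^ (n * (n * 2 ^ n ∸ 2 * totalDist A))
        * (2 * (n * 2 ^ n) ∸ (n * 2 ^ n ∸ 2 * totalDist A)) ^ (n * (2 * (n * 2 ^ n) ∸ (n * 2 ^ n ∸ 2 * totalDist A)))
      ≤ (2 * (n * 2 ^ n)) ^ (n * (2 * (n * 2 ^ n))))
theorem3p9 n _ A nonEmpty = lowerBound n A nonEmpty , upperBound n A nonEmpty
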